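{- For every positive integer $k$ there is no reflexible $4$-maniplex whose automorphism group is isomorphic to ${\rm PSL}_2(2^k)$; equivalently, ${\rm PSL}_2(2^k)$ admits no string representation of rank $4$.
   Context: A string representation of rank $n$ of a group $G$ is an $n$-tuple $(g_0,\ldots,g_{n-1})$ of pairwise distinct involutions of $G$ that generate $G$ and satisfy $g_ig_j=g_jg_i$ whenever $|i-j|>1$. Reflexible $n$-maniplexes with automorphism group $G$ correspond exactly to string representations of $G$ of rank $n$: from such a representation $(\rho_0,\ldots,\rho_{n-1})$ one obtains the maniplex whose flag set is $G$, whose distinguished involutions are left multiplications by the $\rho_i$, and whose automorphism group (acting by right multiplication) is $G$; conversely, the automorphism group of a reflexible $n$-maniplex carries such a representation. -}

module Defs where

open import Level using (Level; _⊔_)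
open import Data.Nat using (ℕ; _<_; _^_; ∣_-_∣)
open import Data.Fin using (Fin; toℕ)
open import Data.List using (List; []; _∷_)
open import Data.Product using (Σ; ∃; _×_; _,_; proj₁)
open import Data.Sum using (_⊎_)
open import Relation.Nullary using (¬_)
open import Relation.Binary.PropositionalEquality using (_≡_; _≢_)
import Relation.Binary.PropositionalEquality as ≡
open import Algebra.Bundles using (CommutativeRing)
open import Function.Bundles using (Bijection)

IsField : ∀ {c ℓ} → CommutativeRing c ℓ → Set (c ⊔ ℓ)
IsField R = (¬ (1# ≈ 0#)) × (∀ x → ¬ (x ≈ 0#) → ∃ λ y → x * y ≈ 1#)
  where open CommutativeRing R

HasOrder : ∀ {c ℓ} → CommutativeRing c ℓ → ℕ → Set (c ⊔ ℓ)
HasOrder R n = Bijection (≡.setoid (Fin n)) (CommutativeRing.setoid R)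

-- String representations of a group G, presented as the subset of an
-- ambient multiplicative structure (carrier, equality, multiplication,
-- identity) cut out by a membership predicate InG that is closed under
-- the operations (used below: G = PSL₂(F) inside 2×2 matrices modulo ±1).

module _ {a ℓ p : Level} {M : Set a} (_≈_ : M → M → Set ℓ)
         (_∙_ : M → M → M) (e : M) (InG : M → Set p) where

  evalWord : ∀ {n} → (Fin n → M) → List (Fin n) → M
  evalWord g []       = e
  evalWord g (i ∷ w)  = g i ∙ evalWord g w

  record StringRep (n : ℕ) : Set (a ⊔ ℓ ⊔ p) where
    field
      gen        : Fin n → M
      gen∈G      : ∀ i → InG (gen i)
      involution : ∀ i → (gen i ∙ gen i) ≈ e × ¬ (gen i ≈ e)
      distinct   : ∀ i j → i ≢ j → ¬ (gen i ≈ gen j)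
      commute    : ∀ i j → 1 < ∣ toℕ i - toℕ j ∣ → (gen i ∙ gen j) ≈ (gen j ∙ gen i)
      -- every element of G is a product of generators (the generators are
      -- involutions and G is finite, so this is generation as a group)
      generates  : ∀ x → InG x → ∃ λ (w : List (Fin n)) → evalWord gen w ≈ x

module PSL2 {c ℓ} (R : CommutativeRing c ℓ) where
  open CommutativeRing R

  record M2 : Set c where
    constructor mat
    field a b c' d : Carrier
  open M2 public

  det : M2 → Carrier
  det m = (a m * d m) - (b m * c' m)

  _·_ : M2 → M2 → M2
  m · n = mat (a m * a n + b m * c' n) (a m * b n + b m * d n)
              (c' m * a n + d m * c' n) (c' m * b n + d m * d n)

  I : M2
  I = mat 1# 0# 0# 1#

  neg : M2 → M2
  neg m = mat (- a m) (- b m) (- c' m) (- d m)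

  _≈M_ : M2 → M2 → Set ℓ
  m ≈M n = (a m ≈ a n) × (b m ≈ b n) × (c' m ≈ c' n) × (d m ≈ d n)

  InSL2 : M2 → Set ℓ
  InSL2 m = det m ≈ 1#

  _≈P_ : M2 → M2 → Set ℓ
  m ≈P n = (m ≈M n) ⊎ (m ≈M neg n)

  PSL2StringRep : ℕ → Set (c ⊔ ℓ)
  PSL2StringRep n = StringRep _≈P_ _·_ I InSL2 n

{-# OPTIONS --safe #-}
-- Let F be the field of order 2ᵏ. Translation by 1 permutes F, so summing over F gives 2ᵏ·1 = 0
-- and F has characteristic 2; in particular −I = I, so PSL₂(F) = SL₂(F). An involution
-- t = [[a,b],[c,d]] then has a = d (its trace squares to 0) and (b,c) ≠ (0,0), and two such
-- involutions commute iff their vectors (b,c) are proportional. In a rank 4 string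
-- representation ρ₀ commutes with ρ₂, ρ₃ and ρ₁ commutes with ρ₃; proportionality through the
-- nonzero vector of ρ₃ makes ρ₀ commute with ρ₁ as well. So ρ₀ is central in SL₂(F), hence
-- commutes with both elementary unipotents [[1,0],[1,1]] and [[1,1],[0,1]], which forces
-- b = c = 0: a contradiction.
module Submission where

open import Defs
open import Data.Nat using (ℕ; zero; suc; _≥_; _^_; _<_; ∣_-_∣; s<s; z<s)
open import Data.Fin using (Fin; toℕ)
import Data.Fin as Fin
open import Data.Fin.Patterns using (0F; 1F; 2F; 3F)
open import Data.Fin.Permutation using (Permutation; permutation)
open import Data.List using ([]; _∷_)
open import Data.Product using (_,_; proj₁; proj₂)
open import Data.Sum using (inj₁; inj₂)
open import Data.Empty using (⊥-elim)
open import Relation.Nullary using (¬_; yes; no)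
open import Relation.Binary.Definitions using (Decidable)
open import Algebra.Bundles using (CommutativeRing)
open import Function.Bundles using (Bijection)

module FiniteRing {c ℓ} (R : CommutativeRing c ℓ) {n : ℕ} (order : HasOrder R n) where
  open CommutativeRing R
  open Bijection order using (to; injective; strictlySurjective) renaming (cong to to-cong)
  open import Algebra.Properties.CommutativeMonoid.Sum +-commutativeMonoid
  open import Algebra.Properties.Group +-group using (identityʳ-unique; //-rightDividesˡ; //-rightDividesʳ)
  open import Algebra.Properties.Semiring.Mult semiring using (_×_)
  open import Relation.Binary.Reasoning.Setoid setoid

  index : Carrier → Fin n
  index x = proj₁ (strictlySurjective x)

  to-index : ∀ x → to (index x) ≈ x
  to-index x = proj₂ (strictlySurjective x)

  _≟_ : Decidable _≈_
  x ≟ y with index x Fin.≟ index y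
  ... | yes i≡j = yes (trans (sym (to-index x)) (trans (to-cong i≡j) (to-index y)))
  ... | no  i≢j = no λ x≈y → i≢j (injective (trans (to-index x) (trans x≈y (sym (to-index y)))))

  translation : Carrier → Permutation n n
  translation z = permutation (λ i → index (to i + z)) (λ i → index (to i - z))
    (λ i → injective (begin
      to (index (to (index (to i - z)) + z)) ≈⟨ to-index _ ⟩
      to (index (to i - z)) + z              ≈⟨ +-congʳ (to-index _) ⟩
      (to i - z) + z                         ≈⟨ //-rightDividesˡ z (to i) ⟩
      to i                                   ∎))
    (λ i → injective (begin
      to (index (to (index (to i + z)) - z)) ≈⟨ to-index _ ⟩
      to (index (to i + z)) - z              ≈⟨ +-congʳ (to-index _) ⟩
      (to i + z) - z                         ≈⟨ //-rightDividesʳ z (to i) ⟩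
      to i                                   ∎))

  order×≈0 : ∀ z → n × z ≈ 0#
  order×≈0 z = identityʳ-unique (sum to) (n × z) (sym (begin
    sum {n} to                         ≈⟨ sum-permute to (translation z) ⟩
    sum (λ i → to (index (to i + z)))  ≈⟨ sum-cong-≋ {n} (λ i → to-index (to i + z)) ⟩
    sum (λ i → to i + z)               ≈⟨ ∑-distrib-+ to (λ _ → z) ⟩
    sum to + sum {n} (λ _ → z)         ≈⟨ +-congˡ (sum-replicate n) ⟩
    sum to + n × z                     ∎))

HasCharacteristic2 : ∀ {c ℓ} → CommutativeRing c ℓ → Set ℓ
HasCharacteristic2 R = 1# + 1# ≈ 0#
  where open CommutativeRing R

module Field {c ℓ} (F : CommutativeRing c ℓ) (isField : IsField F) where
  open CommutativeRing F
  open import Algebra.Solver.Ring.NaturalCoefficients.Default commutativeSemiring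
  open import Algebra.Properties.Semiring.Mult semiring using (_×_; ×1-homo-*)
  open import Relation.Binary.Reasoning.Setoid setoid

  1≉0 : 1# ≉ 0#
  1≉0 = proj₁ isField

  inverse : ∀ {x} → x ≉ 0# → Carrier
  inverse {x} x≉0 = proj₁ (proj₂ isField x x≉0)

  *-inverseʳ : ∀ {x} (x≉0 : x ≉ 0#) → x * inverse x≉0 ≈ 1#
  *-inverseʳ {x} x≉0 = proj₂ (proj₂ isField x x≉0)

  *-nonzero : ∀ {x y} → x ≉ 0# → y ≉ 0# → x * y ≉ 0#
  *-nonzero {x} {y} x≉0 y≉0 xy≈0 = 1≉0 (begin
    1#                                ≈⟨ *-identityʳ 1# ⟨
    1# * 1#                           ≈⟨ *-cong (*-inverseʳ x≉0) (*-inverseʳ y≉0) ⟨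
    (x * x⁻¹) * (y * y⁻¹)             ≈⟨ solve 4 (λ x x' y y' → (x :* x') :* (y :* y') := (x :* y) :* (x' :* y')) refl x x⁻¹ y y⁻¹ ⟩
    (x * y) * (x⁻¹ * y⁻¹)             ≈⟨ *-congʳ xy≈0 ⟩
    0# * (x⁻¹ * y⁻¹)                  ≈⟨ zeroˡ _ ⟩
    0#                                ∎)
    where
    x⁻¹ = inverse x≉0
    y⁻¹ = inverse y≉0

  *-cancelˡ : ∀ {x y z} → x ≉ 0# → x * y ≈ x * z → y ≈ z
  *-cancelˡ {x} {y} {z} x≉0 xy≈xz = begin
    y                  ≈⟨ *-identityˡ y ⟨
    1# * y             ≈⟨ *-congʳ (*-inverseʳ x≉0) ⟨
    (x * x⁻¹) * y      ≈⟨ reassoc x x⁻¹ y ⟩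
    x⁻¹ * (x * y)      ≈⟨ *-congˡ xy≈xz ⟩
    x⁻¹ * (x * z)      ≈⟨ reassoc x x⁻¹ z ⟨
    (x * x⁻¹) * z      ≈⟨ *-congʳ (*-inverseʳ x≉0) ⟩
    1# * z             ≈⟨ *-identityˡ z ⟩
    z                  ∎
    where
    x⁻¹ = inverse x≉0
    reassoc : ∀ u v w → (u * v) * w ≈ v * (u * w)
    reassoc = solve 3 (λ u v w → (u :* v) :* w := v :* (u :* w)) refl

  2^j×1≉0 : 2 × 1# ≉ 0# → ∀ j → (2 ^ j) × 1# ≉ 0#
  2^j×1≉0 2≉0 zero    1+0≈0     = 1≉0 (trans (sym (+-identityʳ 1#)) 1+0≈0)
  2^j×1≉0 2≉0 (suc j) 2^[j+1]≈0 = *-nonzero 2≉0 (2^j×1≉0 2≉0 j) (trans (sym (×1-homo-* 2 (2 ^ j))) 2^[j+1]≈0)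

  module _ {k} (order : HasOrder F (2 ^ k)) where
    open FiniteRing F order

    characteristic2 : HasCharacteristic2 F
    characteristic2 with (2 × 1#) ≟ 0#
    ... | yes 2≈0 = trans (+-congˡ (sym (+-identityʳ 1#))) 2≈0
    ... | no  2≉0 = ⊥-elim (2^j×1≉0 2≉0 k (order×≈0 1#))

  square≈0⇒≈0 : Decidable _≈_ → ∀ {x} → x * x ≈ 0# → x ≈ 0#
  square≈0⇒≈0 _≟_ {x} x²≈0 with x ≟ 0#
  ... | yes x≈0 = x≈0
  ... | no  x≉0 = ⊥-elim (*-nonzero x≉0 x≉0 x²≈0)

module Characteristic2 {c ℓ} (R : CommutativeRing c ℓ) (1+1≈0 : HasCharacteristic2 R) where
  open CommutativeRing R
  open import Algebra.Solver.Ring.NaturalCoefficients.Default commutativeSemiring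
  open import Algebra.Properties.Group +-group using (inverseˡ-unique)
  open import Relation.Binary.Reasoning.Setoid setoid

  x+x≈0 : ∀ x → x + x ≈ 0#
  x+x≈0 x = begin
    x + x                 ≈⟨ +-cong (*-identityˡ x) (*-identityˡ x) ⟨
    1# * x + 1# * x       ≈⟨ distribʳ x 1# 1# ⟨
    (1# + 1#) * x         ≈⟨ *-congʳ 1+1≈0 ⟩
    0# * x                ≈⟨ zeroˡ x ⟩
    0#                    ∎

  -x≈x : ∀ x → - x ≈ x
  -x≈x x = sym (inverseˡ-unique x x (x+x≈0 x))

  x+y≈0⇒x≈y : ∀ {x y} → x + y ≈ 0# → x ≈ y
  x+y≈0⇒x≈y {x} {y} x+y≈0 = trans (inverseˡ-unique x y x+y≈0) (-x≈x y)

  square-+ : ∀ x y → (x + y) * (x + y) ≈ x * x + y * y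
  square-+ x y = begin
    (x + y) * (x + y)                 ≈⟨ solve 2 (λ x y → (x :+ y) :* (x :+ y) := x :* x :+ y :* y :+ (x :* y :+ x :* y)) refl x y ⟩
    x * x + y * y + (x * y + x * y)   ≈⟨ +-congˡ (x+x≈0 (x * y)) ⟩
    x * x + y * y + 0#                ≈⟨ +-identityʳ _ ⟩
    x * x + y * y                     ∎

module Matrices {c ℓ} (R : CommutativeRing c ℓ) where
  open CommutativeRing R
  open PSL2 R
  open import Algebra.Solver.Ring.NaturalCoefficients.Default commutativeSemiring
  open import Algebra.Properties.Group +-group using (∙-cancelˡ; identityʳ-unique; ε⁻¹≈ε)
  open import Relation.Binary.Reasoning.Setoid setoid

  ≈M-refl : ∀ {m} → m ≈M m
  ≈M-refl = refl , refl , refl , refl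

  ≈M-sym : ∀ {m n} → m ≈M n → n ≈M m
  ≈M-sym (p , q , r , s) = sym p , sym q , sym r , sym s

  ≈M-trans : ∀ {m n o} → m ≈M n → n ≈M o → m ≈M o
  ≈M-trans (p , q , r , s) (p′ , q′ , r′ , s′) = trans p p′ , trans q q′ , trans r r′ , trans s s′

  ·-cong : ∀ {m m′ n n′} → m ≈M m′ → n ≈M n′ → (m · n) ≈M (m′ · n′)
  ·-cong (p , q , r , s) (p′ , q′ , r′ , s′) =
    +-cong (*-cong p p′) (*-cong q r′) , +-cong (*-cong p q′) (*-cong q s′) ,
    +-cong (*-cong r p′) (*-cong s r′) , +-cong (*-cong r q′) (*-cong s s′)

  ·-assoc : ∀ m n o → ((m · n) · o) ≈M (m · (n · o))
  ·-assoc m n o = entry _ _ _ _ _ _ _ _ , entry _ _ _ _ _ _ _ _ , entry _ _ _ _ _ _ _ _ , entry _ _ _ _ _ _ _ _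
    where
    entry : ∀ x₁ x₂ y₁ y₂ y₃ y₄ z₁ z₃ →
      (x₁ * y₁ + x₂ * y₃) * z₁ + (x₁ * y₂ + x₂ * y₄) * z₃ ≈ x₁ * (y₁ * z₁ + y₂ * z₃) + x₂ * (y₃ * z₁ + y₄ * z₃)
    entry = solve 8 (λ x₁ x₂ y₁ y₂ y₃ y₄ z₁ z₃ →
      (x₁ :* y₁ :+ x₂ :* y₃) :* z₁ :+ (x₁ :* y₂ :+ x₂ :* y₄) :* z₃ :=
      x₁ :* (y₁ :* z₁ :+ y₂ :* z₃) :+ x₂ :* (y₃ :* z₁ :+ y₄ :* z₃)) refl

  ·-identityˡ : ∀ m → (I · m) ≈M m
  ·-identityˡ m = entry₁ (a m) (c' m) , entry₁ (b m) (d m) , entry₂ (a m) (c' m) , entry₂ (b m) (d m)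
    where
    entry₁ : ∀ x y → 1# * x + 0# * y ≈ x
    entry₁ = solve 2 (λ x y → con 1 :* x :+ con 0 :* y := x) refl
    entry₂ : ∀ x y → 0# * x + 1# * y ≈ y
    entry₂ = solve 2 (λ x y → con 0 :* x :+ con 1 :* y := y) refl

  ·-identityʳ : ∀ m → (m · I) ≈M m
  ·-identityʳ m = entry₁ (a m) (b m) , entry₂ (a m) (b m) , entry₁ (c' m) (d m) , entry₂ (c' m) (d m)
    where
    entry₁ : ∀ x y → x * 1# + y * 0# ≈ x
    entry₁ = solve 2 (λ x y → x :* con 1 :+ y :* con 0 := x) refl
    entry₂ : ∀ x y → x * 0# + y * 1# ≈ y
    entry₂ = solve 2 (λ x y → x :* con 0 :+ y :* con 1 := y) refl

  Commute : M2 → M2 → Set ℓ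
  Commute m n = (m · n) ≈M (n · m)

  commute-I : ∀ t → Commute I t
  commute-I t = ≈M-trans (·-identityˡ t) (≈M-sym (·-identityʳ t))

  commute-· : ∀ {m n t} → Commute m t → Commute n t → Commute (m · n) t
  commute-· {m} {n} {t} mt≈tm nt≈tn =
    ≈M-trans (·-assoc m n t) (≈M-trans (·-cong (≈M-refl {m}) nt≈tn) (≈M-trans (≈M-sym (·-assoc m t n))
      (≈M-trans (·-cong mt≈tm (≈M-refl {n})) (·-assoc t m n))))

  commute-resp : ∀ {m n t} → m ≈M n → Commute m t → Commute n t
  commute-resp m≈n mt≈tm = ≈M-trans (·-cong (≈M-sym m≈n) ≈M-refl) (≈M-trans mt≈tm (·-cong ≈M-refl m≈n))

  commute-evalWord : ∀ {k} {g : Fin k → M2} {t} → (∀ i → Commute (g i) t) →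
                     ∀ w → Commute (evalWord _≈P_ _·_ I InSL2 g w) t
  commute-evalWord gt≈tg []      = commute-I _
  commute-evalWord gt≈tg (i ∷ w) = commute-· (gt≈tg i) (commute-evalWord gt≈tg w)

  lowerUnipotent upperUnipotent : M2
  lowerUnipotent = mat 1# 0# 1# 1#
  upperUnipotent = mat 1# 1# 0# 1#

  det≈1 : ∀ {x y} → x * y ≈ 0# → 1# * 1# - x * y ≈ 1#
  det≈1 xy≈0 = trans (+-cong (*-identityʳ 1#) (trans (-‿cong xy≈0) ε⁻¹≈ε)) (+-identityʳ 1#)

  lowerUnipotent∈SL2 : InSL2 lowerUnipotent
  lowerUnipotent∈SL2 = det≈1 (zeroˡ 1#)

  upperUnipotent∈SL2 : InSL2 upperUnipotent
  upperUnipotent∈SL2 = det≈1 (zeroʳ 1#)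

  commute-lowerUnipotent⇒b≈0 : ∀ {t} → Commute lowerUnipotent t → b t ≈ 0#
  commute-lowerUnipotent⇒b≈0 {t} (a≈a+b , _) = identityʳ-unique (a t) (b t) (sym (begin
    a t                     ≈⟨ solve 2 (λ x y → x := con 1 :* x :+ con 0 :* y) refl (a t) (c' t) ⟩
    1# * a t + 0# * c' t    ≈⟨ a≈a+b ⟩
    a t * 1# + b t * 1#     ≈⟨ +-cong (*-identityʳ (a t)) (*-identityʳ (b t)) ⟩
    a t + b t               ∎))

  commute-upperUnipotent⇒c≈0 : ∀ {t} → Commute upperUnipotent t → c' t ≈ 0#
  commute-upperUnipotent⇒c≈0 {t} (a+c≈a , _) = identityʳ-unique (a t) (c' t) (begin
    a t + c' t              ≈⟨ +-cong (*-identityˡ (a t)) (*-identityˡ (c' t)) ⟨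
    1# * a t + 1# * c' t    ≈⟨ a+c≈a ⟩
    a t * 1# + b t * 0#     ≈⟨ solve 2 (λ x y → x :* con 1 :+ y :* con 0 := x) refl (a t) (b t) ⟩
    a t                     ∎)

  Proportional : M2 → M2 → Set ℓ
  Proportional s t = b s * c' t ≈ b t * c' s

  commute⇒proportional : ∀ {s t} → Commute s t → Proportional s t
  commute⇒proportional {s} {t} (st≈ts , _) =
    ∙-cancelˡ (a s * a t) _ _ (trans st≈ts (+-congʳ (*-comm (a t) (a s))))

  proportional⇒commute : ∀ {s t} → a s ≈ d s → a t ≈ d t → Proportional s t → Commute s t
  proportional⇒commute {s} {t} aₛ≈dₛ aₜ≈dₜ p =
    +-cong (*-comm (a s) (a t)) p ,
    trans (+-cong (*-cong-swap aₛ≈dₛ refl) (*-cong-swap refl (sym aₜ≈dₜ))) (+-comm _ _) ,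
    trans (+-cong (*-cong-swap refl aₜ≈dₜ) (*-cong-swap (sym aₛ≈dₛ) refl)) (+-comm _ _) ,
    +-cong (trans (*-comm (c' s) (b t)) (trans (sym p) (*-comm (b s) (c' t)))) (*-comm (d s) (d t))
    where
    *-cong-swap : ∀ {x x′ y y′} → x ≈ x′ → y ≈ y′ → x * y ≈ y′ * x′
    *-cong-swap {x′ = x′} {y′ = y′} x≈x′ y≈y′ = trans (*-cong x≈x′ y≈y′) (*-comm x′ y′)

module SL2Characteristic2 {c ℓ} (F : CommutativeRing c ℓ) (isField : IsField F)
  (_≟_ : Decidable (CommutativeRing._≈_ F)) (1+1≈0 : HasCharacteristic2 F) where
  open CommutativeRing F
  open Field F isField using (*-cancelˡ; square≈0⇒≈0)
  open Characteristic2 F 1+1≈0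
  open PSL2 F
  open Matrices F
  open import Algebra.Solver.Ring.NaturalCoefficients.Default commutativeSemiring
  open import Algebra.Properties.Group +-group using (∙-cancelʳ)
  open import Relation.Binary.Reasoning.Setoid setoid

  square-injective : ∀ {x y} → x * x ≈ y * y → x ≈ y
  square-injective {x} {y} x²≈y² = x+y≈0⇒x≈y (square≈0⇒≈0 _≟_ (begin
    (x + y) * (x + y)  ≈⟨ square-+ x y ⟩
    x * x + y * y      ≈⟨ +-congʳ x²≈y² ⟩
    y * y + y * y      ≈⟨ x+x≈0 (y * y) ⟩
    0#                 ∎))

  ≈P⇒≈M : ∀ {m n} → m ≈P n → m ≈M n
  ≈P⇒≈M (inj₁ m≈n)  = m≈n
  ≈P⇒≈M (inj₂ m≈-n) = ≈M-trans m≈-n (-x≈x _ , -x≈x _ , -x≈x _ , -x≈x _)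

  proportional-trans : ∀ {s t u} → (b t ≈ 0# → c' t ≉ 0#) →
                       Proportional s t → Proportional t u → Proportional s u
  proportional-trans {s} {t} {u} t≉0 p q with b t ≟ 0#
  ... | no bₜ≉0 = *-cancelˡ bₜ≉0 (begin
    b t * (b s * c' u)  ≈⟨ swap₁₂ _ _ _ ⟩
    b s * (b t * c' u)  ≈⟨ *-congˡ q ⟩
    b s * (b u * c' t)  ≈⟨ swap₁₂ _ _ _ ⟩
    b u * (b s * c' t)  ≈⟨ *-congˡ p ⟩
    b u * (b t * c' s)  ≈⟨ swap₁₂ _ _ _ ⟩
    b t * (b u * c' s)  ∎)
    where
    swap₁₂ : ∀ x y z → x * (y * z) ≈ y * (x * z)
    swap₁₂ = solve 3 (λ x y z → x :* (y :* z) := y :* (x :* z)) refl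
  ... | yes bₜ≈0 = *-cancelˡ (t≉0 bₜ≈0) (begin
    c' t * (b s * c' u)  ≈⟨ swap₁₃ _ _ _ ⟩
    c' u * (b s * c' t)  ≈⟨ *-congˡ p ⟩
    c' u * (b t * c' s)  ≈⟨ swap₁₃ _ _ _ ⟩
    c' s * (b t * c' u)  ≈⟨ *-congˡ q ⟩
    c' s * (b u * c' t)  ≈⟨ swap₁₃ _ _ _ ⟩
    c' t * (b u * c' s)  ∎)
    where
    swap₁₃ : ∀ x y z → x * (y * z) ≈ z * (y * x)
    swap₁₃ = solve 3 (λ x y z → x :* (y :* z) := z :* (y :* x)) refl

  module Involution {t} (t²≈I : (t · t) ≈M I) where
    private
      a²+bc≈1 : a t * a t + b t * c' t ≈ 1#
      a²+bc≈1 = proj₁ t²≈I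
      cb+d²≈1 : c' t * b t + d t * d t ≈ 1#
      cb+d²≈1 = proj₂ (proj₂ (proj₂ t²≈I))

    diagonal : a t ≈ d t
    diagonal = square-injective (∙-cancelʳ (b t * c' t) _ _ (begin
      a t * a t + b t * c' t  ≈⟨ trans a²+bc≈1 (sym cb+d²≈1) ⟩
      c' t * b t + d t * d t  ≈⟨ +-comm _ _ ⟩
      d t * d t + c' t * b t  ≈⟨ +-congˡ (*-comm (c' t) (b t)) ⟩
      d t * d t + b t * c' t  ∎))

    offDiagonal≉0 : ¬ (t ≈P I) → b t ≈ 0# → c' t ≉ 0#
    offDiagonal≉0 t≉I bₜ≈0 cₜ≈0 = t≉I (inj₁ (aₜ≈1 , bₜ≈0 , cₜ≈0 , trans (sym diagonal) aₜ≈1))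
      where
      aₜ≈1 : a t ≈ 1#
      aₜ≈1 = square-injective (begin
        a t * a t               ≈⟨ +-identityʳ _ ⟨
        a t * a t + 0#          ≈⟨ +-congˡ (trans (*-congʳ bₜ≈0) (zeroˡ (c' t))) ⟨
        a t * a t + b t * c' t  ≈⟨ a²+bc≈1 ⟩
        1#                      ≈⟨ *-identityʳ 1# ⟨
        1# * 1#                 ∎)

  noRank4StringRep : ¬ PSL2StringRep 4
  noRank4StringRep ρ = offDiagonal≉0 0F
    (commute-lowerUnipotent⇒b≈0 (central lowerUnipotent∈SL2))
    (commute-upperUnipotent⇒c≈0 (central upperUnipotent∈SL2))
    where
    open StringRep ρ

    t²≈I : ∀ i → (gen i · gen i) ≈M I
    t²≈I i = ≈P⇒≈M (proj₁ (involution i))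

    diagonal : ∀ i → a (gen i) ≈ d (gen i)
    diagonal i = Involution.diagonal (t²≈I i)

    offDiagonal≉0 : ∀ i → b (gen i) ≈ 0# → c' (gen i) ≉ 0#
    offDiagonal≉0 i = Involution.offDiagonal≉0 (t²≈I i) (proj₂ (involution i))

    commuting : ∀ i j → 1 < ∣ toℕ i - toℕ j ∣ → Commute (gen i) (gen j)
    commuting i j far = ≈P⇒≈M (commute i j far)

    commute-ρ₀ : ∀ i → Commute (gen i) (gen 0F)
    commute-ρ₀ 0F = ≈M-refl
    commute-ρ₀ 1F = proportional⇒commute (diagonal 1F) (diagonal 0F)
      (proportional-trans {gen 1F} {gen 3F} {gen 0F} (offDiagonal≉0 3F)
        (commute⇒proportional (commuting 1F 3F (s<s z<s)))
        (commute⇒proportional (commuting 3F 0F (s<s z<s))))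
    commute-ρ₀ 2F = commuting 2F 0F (s<s z<s)
    commute-ρ₀ 3F = commuting 3F 0F (s<s z<s)

    central : ∀ {x} → InSL2 x → Commute x (gen 0F)
    central x∈G = let w , w≈x = generates _ x∈G in
      commute-resp (≈P⇒≈M w≈x) (commute-evalWord commute-ρ₀ w)

mainTheorem6 : ∀ {c ℓ} (k : ℕ) → k ≥ 1 → (F : CommutativeRing c ℓ) → IsField F → HasOrder F (2 ^ k)
    → ¬ PSL2.PSL2StringRep F 4
mainTheorem6 k _ F isField order =
  SL2Characteristic2.noRank4StringRep F isField (FiniteRing._≟_ F order) (Field.characteristic2 F isField {k} order)
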